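{- Let $c_0$ be a $2$-colouring of the four points of $\mathrm{PG}(1,3)$ in which exactly two points receive each colour. If $n\ge 2$ and $c$ is a $c_0$-free $2$-colouring of $G=\mathrm{PG}(n-1,3)$, then $G$ has a monochromatic subspace of dimension at least $\lceil n/2\rceil$. Moreover, this is best possible: for every $n\ge2$ there is a $c_0$-free $2$-colouring of $\mathrm{PG}(n-1,3)$ with no monochromatic subspace of dimension greater than $\lceil n/2\rceil$.
   Context: $\mathrm{PG}(n-1,3)$ has as points the one-dimensional subspaces of $\mathbb F_3^n$; a subspace of it consists of the points contained in a linear subspace of $\mathbb F_3^n$, of the same dimension. For colourings $c$ of $\mathrm{PG}(n-1,3)$ and $c_0$ of $\mathrm{PG}(1,3)$, $c$ contains $c_0$ if there is an injective linear map $\psi:\mathbb F_3^2\to\mathbb F_3^n$ such that for each point $x$ of $\mathrm{PG}(1,3)$ the colour under $c$ of the point $\psi(x)$ equals $c_0(x)$; $c$ is $c_0$-free if it does not contain $c_0$. A set is monochromatic if all its points have the same colour. -}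

module Defs where

open import Data.Nat using (ℕ; zero; suc; _≤_)
open import Data.Bool using (Bool; true; false)
open import Data.Vec using (Vec; []; _∷_; map; zipWith; replicate)
open import Data.Product using (Σ; ∃; _×_; _,_)
open import Relation.Binary.PropositionalEquality using (_≡_; _≢_)
open import Relation.Nullary using (¬_)

data F3 : Set where
  f0 f1 f2 : F3

_+₃_ : F3 → F3 → F3
f0 +₃ y = y
f1 +₃ f0 = f1
f1 +₃ f1 = f2
f1 +₃ f2 = f0
f2 +₃ f0 = f2
f2 +₃ f1 = f0
f2 +₃ f2 = f1

_*₃_ : F3 → F3 → F3
f0 *₃ _ = f0
f1 *₃ y = y
f2 *₃ f0 = f0
f2 *₃ f1 = f2
f2 *₃ f2 = f1

V : ℕ → Set
V n = Vec F3 n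

zeroV : (n : ℕ) → V n
zeroV n = replicate n f0

scale : {n : ℕ} → F3 → V n → V n
scale a v = map (a *₃_) v

-- The linear map F_3^d → F_3^n whose i-th column is the i-th vector of vs:
-- x ↦ Σ_i x_i vs_i.  Every linear map F_3^d → F_3^n is of this form.
lin : {n d : ℕ} → Vec (V n) d → V d → V n
lin {n} [] [] = zeroV n
lin (v ∷ vs) (a ∷ x) = zipWith _+₃_ (scale a v) (lin vs x)

InjectiveLin : {n d : ℕ} → Vec (V n) d → Set
InjectiveLin {n} {d} vs = (x y : V d) → lin vs x ≡ lin vs y → x ≡ y

-- A 2-colouring of PG(n-1,3): a colour for each nonzero vector of F_3^n which
-- is constant on each 1-dimensional subspace, i.e. invariant under the only
-- nontrivial scalar 2 = -1.  (The value at the zero vector is never used.)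
record Colouring (n : ℕ) : Set where
  field
    col : V n → Bool
    inv : (v : V n) → col (scale f2 v) ≡ col v
open Colouring public

Contains : {n : ℕ} → Colouring n → Colouring 2 → Set
Contains {n} c c0 =
  Σ (Vec (V n) 2) λ ψ → InjectiveLin ψ ×
    ((x : V 2) → x ≢ zeroV 2 → col c (lin ψ x) ≡ col c0 x)

Free : {n : ℕ} → Colouring n → Colouring 2 → Set
Free c c0 = ¬ Contains c c0

-- A monochromatic subspace of (vector-space) dimension d: the image of an
-- injective linear map F_3^d → F_3^n all of whose points have one colour.
MonoSubspace : {n : ℕ} → Colouring n → ℕ → Set
MonoSubspace {n} c d =
  Σ (Vec (V n) d) λ vs → InjectiveLin vs ×
    ∃ λ (b : Bool) → (x : V d) → x ≢ zeroV d → col c (lin vs x) ≡ b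

HasMonoAtLeast : {n : ℕ} → Colouring n → ℕ → Set
HasMonoAtLeast c k = ∃ λ d → k ≤ d × MonoSubspace c d

count4 : Bool → Bool → Bool → Bool → ℕ
count4 a b c d = b2n a Data.Nat.+ (b2n b Data.Nat.+ (b2n c Data.Nat.+ b2n d))
  where
  b2n : Bool → ℕ
  b2n true = 1
  b2n false = 0

-- The four points of PG(1,3) are represented by (1,0), (0,1), (1,1), (1,2).
-- Balanced: exactly two of them receive each colour.
Balanced : Colouring 2 → Set
Balanced c0 =
  count4 (col c0 (f1 ∷ f0 ∷ [])) (col c0 (f0 ∷ f1 ∷ []))
         (col c0 (f1 ∷ f1 ∷ [])) (col c0 (f1 ∷ f2 ∷ [])) ≡ 2

{-# OPTIONS --safe #-}
module Submission where

-- Call a line of PG(n-1,3) balanced if two of its four points have each colour. As PGL(2,3)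
-- permutes the four points of PG(1,3) arbitrarily, a colouring contains the balanced c0 exactly
-- when it has a balanced line.
--
-- Lower bound: a colouring without balanced lines has a red subspace R and a blue subspace B with
-- dim R + dim B = n. By induction they exist in the hyperplane x₀ = 0; consider the points
-- (1, r + b) for r ∈ R, b ∈ B. If some translate (1, R + b) is all red, it spans with R a red
-- subspace of one more dimension, and dually for blue. Otherwise the blue points of every
-- (1, R + b) form a nonempty set containing the third point of any affine line through two of
-- them, as the point at infinity of that line lies in R and is red; so they form an affine
-- subspace, of odd size 3ᵏ. Likewise for the red points of every (1, r + B). Counting blue
-- points along the first family and red points along the second gives two odd numbers adding
-- up to the odd number 3^(dim R + dim B).
--
-- Upper bound: colour a point by the parity of the number of leading zeros. On any line, the
-- first coordinate not vanishing on the whole line vanishes at exactly one of its four points,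
-- so three points share a colour. A subspace of colour b meets the subspace where the
-- coordinates at positions of parity b vanish only in 0, so its dimension is at most their
-- number, ⌈n/2⌉ or ⌊n/2⌋.

open import Defs
open import Algebra.Bundles using (CommutativeRing)
open import Data.Bool using (Bool; true; false; not; _xor_; _∨_)
open import Data.Bool.Properties
  using (xor-∧-commutativeRing; xor-same; xor-identityʳ; ∨-zeroʳ; not-injective; ¬-not)
  renaming (_≟_ to _≟B_)
open import Algebra.Properties.CommutativeSemigroup (CommutativeRing.+-commutativeSemigroup xor-∧-commutativeRing)
  using (interchange)
open import Data.Empty using (⊥; ⊥-elim)
open import Data.Fin using (Fin; combine; remQuot)
open import Data.Fin.Properties using (injective⇒≤; remQuot-combine; combine-remQuot)
open import Data.Nat using (ℕ; zero; suc; _+_; _≤_; _^_; ⌈_/2⌉; ⌊_/2⌋; z≤n; s≤s) renaming (_≟_ to _≟ℕ_)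
open import Data.Nat.Properties
  using (≤-refl; ≤-trans; _≤?_; ≰⇒>; ≮⇒≥; <⇒≱; <-irrefl; +-suc; +-comm; +-mono-<-≤; ^-monoʳ-<;
         ⌊n/2⌋≤⌈n/2⌉; ⌊n/2⌋+⌈n/2⌉≡n)
open import Data.Product using (Σ; ∃; _×_; _,_; proj₁; proj₂; uncurry)
import Data.Product as Product
open import Data.Sum using (_⊎_; inj₁; inj₂)
import Data.Sum as Sum
open import Data.Vec using (Vec; []; _∷_; map; zipWith)
open import Data.Vec.Properties
  using (∷-injective; ∷-injectiveˡ; ∷-injectiveʳ; ≡-dec; map-id; map-const; zipWith-assoc; zipWith-comm;
         zipWith-identityˡ; zipWith-identityʳ)
open import Function using (_∘_; id)
open import Relation.Binary.Definitions using (DecidableEquality)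
open import Relation.Binary.PropositionalEquality
  using (_≡_; _≢_; refl; sym; trans; cong; cong₂; subst; module ≡-Reasoning)
open import Relation.Nullary using (Dec; yes; no)
open import Relation.Nullary.Decidable
  using (True; toWitness; map′; _×-dec_; _→-dec_; ¬?; from-yes; decidable-stable)
open import Relation.Unary using (Decidable)

variable
  m n d k : ℕ
  β : Bool

infix 4 _≟F_ _≟V_

_≟F_ : DecidableEquality F3
f0 ≟F f0 = yes refl
f1 ≟F f1 = yes refl
f2 ≟F f2 = yes refl
f0 ≟F f1 = no λ ()
f0 ≟F f2 = no λ ()
f1 ≟F f0 = no λ ()
f1 ≟F f2 = no λ ()
f2 ≟F f0 = no λ ()
f2 ≟F f1 = no λ ()

_≟V_ : DecidableEquality (V n)
_≟V_ = ≡-dec _≟F_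

∀F? : {P : F3 → Set} → Decidable P → Dec (∀ x → P x)
∀F? {P} P? = map′ every (λ p → p f0 , p f1 , p f2) (P? f0 ×-dec P? f1 ×-dec P? f2)
  where
  every : P f0 × P f1 × P f2 → ∀ x → P x
  every (p₀ , _ , _) f0 = p₀
  every (_ , p₁ , _) f1 = p₁
  every (_ , _ , p₂) f2 = p₂

∀V? : {P : V m → Set} → Decidable P → Dec (∀ v → P v)
∀V? {zero} P? = map′ (λ { p [] → p }) (λ p → p []) (P? [])
∀V? {suc m} P? =
  map′ (λ { p (a ∷ v) → p a v }) (λ p a v → p (a ∷ v)) (∀F? λ a → ∀V? λ v → P? (a ∷ v))

∀B? : {P : Bool → Set} → Decidable P → Dec (∀ b → P b)
∀B? {P} P? = map′ every (λ p → p false , p true) (P? false ×-dec P? true)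
  where
  every : P false × P true → ∀ b → P b
  every (p₀ , _) false = p₀
  every (_ , p₁) true = p₁

+₃-identityʳ : ∀ x → x +₃ f0 ≡ x
+₃-identityʳ = from-yes (∀F? λ x → x +₃ f0 ≟F x)

+₃-comm : ∀ x y → x +₃ y ≡ y +₃ x
+₃-comm = from-yes (∀F? λ x → ∀F? λ y → x +₃ y ≟F y +₃ x)

+₃-assoc : ∀ x y z → (x +₃ y) +₃ z ≡ x +₃ (y +₃ z)
+₃-assoc = from-yes (∀F? λ x → ∀F? λ y → ∀F? λ z → (x +₃ y) +₃ z ≟F x +₃ (y +₃ z))

+₃-interchange : ∀ x y z w → (x +₃ y) +₃ (z +₃ w) ≡ (x +₃ z) +₃ (y +₃ w)
+₃-interchange = from-yes (∀F? λ x → ∀F? λ y → ∀F? λ z → ∀F? λ w →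
  (x +₃ y) +₃ (z +₃ w) ≟F (x +₃ z) +₃ (y +₃ w))

+₃-cancelˡ : ∀ w x y → w +₃ x ≡ w +₃ y → x ≡ y
+₃-cancelˡ = from-yes (∀F? λ w → ∀F? λ x → ∀F? λ y → (w +₃ x ≟F w +₃ y) →-dec (x ≟F y))

+₃-twice : ∀ x y → (x +₃ y) +₃ y ≡ x +₃ (f2 *₃ y)
+₃-twice = from-yes (∀F? λ x → ∀F? λ y → (x +₃ y) +₃ y ≟F x +₃ (f2 *₃ y))

+₃-sub-cancel : ∀ x y → x +₃ (y +₃ (f2 *₃ x)) ≡ y
+₃-sub-cancel = from-yes (∀F? λ x → ∀F? λ y → x +₃ (y +₃ (f2 *₃ x)) ≟F y)

+₃-inverseʳ : ∀ x → x +₃ (f2 *₃ x) ≡ f0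
+₃-inverseʳ = from-yes (∀F? λ x → x +₃ (f2 *₃ x) ≟F f0)

+₃-sub≡0⇒≡ : ∀ x y → x +₃ (f2 *₃ y) ≡ f0 → x ≡ y
+₃-sub≡0⇒≡ = from-yes (∀F? λ x → ∀F? λ y → (x +₃ (f2 *₃ y) ≟F f0) →-dec (x ≟F y))

*₃-identityʳ : ∀ a → a *₃ f1 ≡ a
*₃-identityʳ = from-yes (∀F? λ a → a *₃ f1 ≟F a)

*₃-zeroʳ : ∀ a → a *₃ f0 ≡ f0
*₃-zeroʳ = from-yes (∀F? λ a → a *₃ f0 ≟F f0)

*₃-assoc : ∀ a b x → a *₃ (b *₃ x) ≡ (a *₃ b) *₃ x
*₃-assoc = from-yes (∀F? λ a → ∀F? λ b → ∀F? λ x → a *₃ (b *₃ x) ≟F (a *₃ b) *₃ x)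

*₃-distribˡ : ∀ a x y → a *₃ (x +₃ y) ≡ (a *₃ x) +₃ (a *₃ y)
*₃-distribˡ = from-yes (∀F? λ a → ∀F? λ x → ∀F? λ y →
  a *₃ (x +₃ y) ≟F (a *₃ x) +₃ (a *₃ y))

*₃-distribʳ : ∀ a b x → (a +₃ b) *₃ x ≡ (a *₃ x) +₃ (b *₃ x)
*₃-distribʳ = from-yes (∀F? λ a → ∀F? λ b → ∀F? λ x →
  (a +₃ b) *₃ x ≟F (a *₃ x) +₃ (b *₃ x))

*₃-cancelʳ : ∀ x a b → x ≢ f0 → a *₃ x ≡ b *₃ x → a ≡ b
*₃-cancelʳ = from-yes (∀F? λ x → ∀F? λ a → ∀F? λ b →
  ¬? (x ≟F f0) →-dec (a *₃ x ≟F b *₃ x →-dec a ≟F b))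

infixl 6 _⊕_ _⊖_

_⊕_ : V n → V n → V n
u ⊕ v = zipWith _+₃_ u v

_⊖_ : V n → V n → V n
u ⊖ v = u ⊕ scale f2 v

⊕-assoc : (u v w : V n) → (u ⊕ v) ⊕ w ≡ u ⊕ (v ⊕ w)
⊕-assoc = zipWith-assoc +₃-assoc

⊕-comm : (u v : V n) → u ⊕ v ≡ v ⊕ u
⊕-comm = zipWith-comm +₃-comm

⊕-identityˡ : (u : V n) → zeroV n ⊕ u ≡ u
⊕-identityˡ = zipWith-identityˡ λ _ → refl

⊕-identityʳ : (u : V n) → u ⊕ zeroV n ≡ u
⊕-identityʳ = zipWith-identityʳ +₃-identityʳ

⊕-interchange : (u v w x : V n) → (u ⊕ v) ⊕ (w ⊕ x) ≡ (u ⊕ w) ⊕ (v ⊕ x)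
⊕-interchange [] [] [] [] = refl
⊕-interchange (a ∷ u) (b ∷ v) (c ∷ w) (e ∷ x) =
  cong₂ _∷_ (+₃-interchange a b c e) (⊕-interchange u v w x)

⊕-cancelˡ : (w u v : V n) → w ⊕ u ≡ w ⊕ v → u ≡ v
⊕-cancelˡ [] [] [] _ = refl
⊕-cancelˡ (c ∷ w) (a ∷ u) (b ∷ v) eq with ∷-injective eq
... | head , tail = cong₂ _∷_ (+₃-cancelˡ c a b head) (⊕-cancelˡ w u v tail)

⊕-twice : (u v : V n) → (u ⊕ v) ⊕ v ≡ u ⊖ v
⊕-twice [] [] = refl
⊕-twice (a ∷ u) (b ∷ v) = cong₂ _∷_ (+₃-twice a b) (⊕-twice u v)

u⊕[v⊖u]≡v : (u v : V n) → u ⊕ (v ⊖ u) ≡ v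
u⊕[v⊖u]≡v [] [] = refl
u⊕[v⊖u]≡v (a ∷ u) (b ∷ v) = cong₂ _∷_ (+₃-sub-cancel a b) (u⊕[v⊖u]≡v u v)

⊖-self : (u : V n) → u ⊖ u ≡ zeroV n
⊖-self [] = refl
⊖-self (a ∷ u) = cong₂ _∷_ (+₃-inverseʳ a) (⊖-self u)

⊖≡0⇒≡ : (u v : V n) → u ⊖ v ≡ zeroV n → u ≡ v
⊖≡0⇒≡ [] [] _ = refl
⊖≡0⇒≡ (a ∷ u) (b ∷ v) eq with ∷-injective eq
... | head , tail = cong₂ _∷_ (+₃-sub≡0⇒≡ a b head) (⊖≡0⇒≡ u v tail)

scale-zero : (u : V n) → scale f0 u ≡ zeroV n
scale-zero u = map-const u f0

scale-one : (u : V n) → scale f1 u ≡ u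
scale-one = map-id

scale-zeroV : (a : F3) → scale a (zeroV n) ≡ zeroV n
scale-zeroV {zero} a = refl
scale-zeroV {suc n} a = cong₂ _∷_ (*₃-zeroʳ a) (scale-zeroV a)

scale-⊕ : (a : F3) (u v : V n) → scale a (u ⊕ v) ≡ scale a u ⊕ scale a v
scale-⊕ a [] [] = refl
scale-⊕ a (x ∷ u) (y ∷ v) = cong₂ _∷_ (*₃-distribˡ a x y) (scale-⊕ a u v)

scale-+₃ : (a b : F3) (u : V n) → scale (a +₃ b) u ≡ scale a u ⊕ scale b u
scale-+₃ a b [] = refl
scale-+₃ a b (x ∷ u) = cong₂ _∷_ (*₃-distribʳ a b x) (scale-+₃ a b u)

scale-scale : (a b : F3) (u : V n) → scale a (scale b u) ≡ scale (a *₃ b) u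
scale-scale a b [] = refl
scale-scale a b (x ∷ u) = cong₂ _∷_ (*₃-assoc a b x) (scale-scale a b u)

scale-f2-involutive : (u : V n) → scale f2 (scale f2 u) ≡ u
scale-f2-involutive u = trans (scale-scale f2 f2 u) (scale-one u)

scale-cancel : (v : V n) (a b : F3) → v ≢ zeroV n → scale a v ≡ scale b v → a ≡ b
scale-cancel [] a b v≢0 _ = ⊥-elim (v≢0 refl)
scale-cancel (f0 ∷ v) a b v≢0 eq = scale-cancel v a b (v≢0 ∘ cong (f0 ∷_)) (∷-injectiveʳ eq)
scale-cancel (f1 ∷ v) a b _ eq = *₃-cancelʳ f1 a b (λ ()) (∷-injectiveˡ eq)
scale-cancel (f2 ∷ v) a b _ eq = *₃-cancelʳ f2 a b (λ ()) (∷-injectiveˡ eq)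

-- Linear maps and dimension

lin-zero : (X : Vec (V n) d) → lin X (zeroV d) ≡ zeroV n
lin-zero [] = refl
lin-zero (v ∷ X) = trans (cong₂ _⊕_ (scale-zero v) (lin-zero X)) (⊕-identityˡ _)

lin-⊕ : (X : Vec (V n) d) (x y : V d) → lin X (x ⊕ y) ≡ lin X x ⊕ lin X y
lin-⊕ {n} [] [] [] = sym (⊕-identityˡ (zeroV n))
lin-⊕ (v ∷ X) (a ∷ x) (b ∷ y) =
  trans (cong₂ _⊕_ (scale-+₃ a b v) (lin-⊕ X x y)) (⊕-interchange _ _ _ _)

lin-scale : (X : Vec (V n) d) (a : F3) (x : V d) → lin X (scale a x) ≡ scale a (lin X x)
lin-scale [] a [] = sym (scale-zeroV a)
lin-scale (v ∷ X) a (b ∷ x) =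
  trans (cong₂ _⊕_ (sym (scale-scale a b v)) (lin-scale X a x)) (sym (scale-⊕ a _ _))

lin-⊖ : (X : Vec (V n) d) (x y : V d) → lin X (x ⊖ y) ≡ lin X x ⊖ lin X y
lin-⊖ X x y = trans (lin-⊕ X x (scale f2 y)) (cong (lin X x ⊕_) (lin-scale X f2 y))

lin-comp : (ψ : Vec (V n) k) (φ : Vec (V k) d) (x : V d) → lin (map (lin ψ) φ) x ≡ lin ψ (lin φ x)
lin-comp ψ [] [] = sym (lin-zero ψ)
lin-comp ψ (u ∷ φ) (a ∷ x) =
  trans (cong₂ _⊕_ (sym (lin-scale ψ a u)) (lin-comp ψ φ x)) (sym (lin-⊕ ψ _ _))

lin-nonzero : (X : Vec (V n) d) {x : V d} → InjectiveLin X → x ≢ zeroV d → lin X x ≢ zeroV n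
lin-nonzero X {x} inj x≢0 Xx≡0 = x≢0 (inj x _ (trans Xx≡0 (sym (lin-zero X))))

lin-pair : (u v : V n) (a b : F3) → lin (u ∷ v ∷ []) (a ∷ b ∷ []) ≡ scale a u ⊕ scale b v
lin-pair u v a b = cong (scale a u ⊕_) (⊕-identityʳ (scale b v))

lin-lift : (X : Vec (V n) d) (x : V d) → lin (map (f0 ∷_) X) x ≡ f0 ∷ lin X x
lin-lift [] [] = refl
lin-lift (v ∷ X) (a ∷ x) rewrite lin-lift X x =
  cong (_∷ (scale a v ⊕ lin X x)) (trans (+₃-identityʳ (a *₃ f0)) (*₃-zeroʳ a))

lift-injective : (X : Vec (V n) d) → InjectiveLin X → InjectiveLin (map (f0 ∷_) X)
lift-injective X inj x y eq =
  inj x y (∷-injectiveʳ (trans (sym (lin-lift X x)) (trans eq (lin-lift X y))))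

cone : V n → Vec (V n) d → Vec (V (suc n)) (suc d)
cone q X = (f1 ∷ q) ∷ map (f0 ∷_) X

lin-cone : (q : V n) (X : Vec (V n) d) (t : F3) (y : V d) →
           lin (cone q X) (t ∷ y) ≡ t ∷ (scale t q ⊕ lin X y)
lin-cone q X t y rewrite lin-lift X y =
  cong (_∷ (scale t q ⊕ lin X y)) (trans (+₃-identityʳ (t *₃ f1)) (*₃-identityʳ t))

cone-injective : (q : V n) (X : Vec (V n) d) → InjectiveLin X → InjectiveLin (cone q X)
cone-injective q X inj (t ∷ y) (t′ ∷ y′) eq
  with ∷-injective (trans (sym (lin-cone q X t y)) (trans eq (lin-cone q X t′ y′)))
... | refl , tails = cong (t ∷_) (inj y y′ (⊕-cancelˡ (scale t q) _ _ tails))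

singleton-injective : (v : V n) → v ≢ zeroV n → InjectiveLin (v ∷ [])
singleton-injective v v≢0 (a ∷ []) (b ∷ []) eq =
  cong (_∷ []) (scale-cancel v a b v≢0 (trans (sym (⊕-identityʳ _)) (trans eq (⊕-identityʳ _))))

kernel-trivial⇒injective : (f : V d → V k) → (∀ x y → f (x ⊖ y) ≡ f x ⊖ f y) →
                           (∀ x → x ≢ zeroV d → f x ≢ zeroV k) → ∀ x y → f x ≡ f y → x ≡ y
kernel-trivial⇒injective f f-⊖ kernel x y fx≡fy =
  ⊖≡0⇒≡ x y (decidable-stable (x ⊖ y ≟V zeroV _) λ x⊖y≢0 → kernel (x ⊖ y) x⊖y≢0 f[x⊖y]≡0)
  where
  f[x⊖y]≡0 : f (x ⊖ y) ≡ zeroV _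
  f[x⊖y]≡0 = trans (f-⊖ x y) (trans (cong (_⊖ f y) fx≡fy) (⊖-self (f y)))

toFin3 : F3 → Fin 3
toFin3 f0 = Fin.zero
toFin3 f1 = Fin.suc Fin.zero
toFin3 f2 = Fin.suc (Fin.suc Fin.zero)

fromFin3 : Fin 3 → F3
fromFin3 Fin.zero = f0
fromFin3 (Fin.suc Fin.zero) = f1
fromFin3 (Fin.suc (Fin.suc Fin.zero)) = f2

toFin3-fromFin3 : (i : Fin 3) → toFin3 (fromFin3 i) ≡ i
toFin3-fromFin3 Fin.zero = refl
toFin3-fromFin3 (Fin.suc Fin.zero) = refl
toFin3-fromFin3 (Fin.suc (Fin.suc Fin.zero)) = refl

fromFin3-toFin3 : (a : F3) → fromFin3 (toFin3 a) ≡ a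
fromFin3-toFin3 f0 = refl
fromFin3-toFin3 f1 = refl
fromFin3-toFin3 f2 = refl

encode : V m → Fin (3 ^ m)
encode [] = Fin.zero
encode (a ∷ v) = combine (toFin3 a) (encode v)

decode : Fin (3 ^ m) → V m
decode {zero} _ = []
decode {suc m} i = uncurry (λ j k → fromFin3 j ∷ decode k) (remQuot (3 ^ m) i)

decode-encode : (v : V m) → decode (encode v) ≡ v
decode-encode [] = refl
decode-encode {suc m} (a ∷ v) =
  trans (cong (uncurry λ j k → fromFin3 j ∷ decode k) (remQuot-combine (toFin3 a) (encode v)))
        (cong₂ _∷_ (fromFin3-toFin3 a) (decode-encode v))

encode-decode : (i : Fin (3 ^ m)) → encode (decode {m} i) ≡ i
encode-decode {zero} Fin.zero = refl
encode-decode {suc m} i =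
  trans (cong₂ combine (toFin3-fromFin3 (proj₁ q)) (encode-decode {m} (proj₂ q)))
        (combine-remQuot {3} (3 ^ m) i)
  where
  q : Fin 3 × Fin (3 ^ m)
  q = remQuot {3} (3 ^ m) i

injective⇒dim≤ : (f : V d → V k) → (∀ x y → f x ≡ f y → x ≡ y) → d ≤ k
injective⇒dim≤ {d} {k} f inj =
  ≮⇒≥ λ k<d → <⇒≱ (^-monoʳ-< 3 (s≤s (s≤s z≤n)) k<d) (injective⇒≤ g-injective)
  where
  encode-injective : ∀ {u v : V k} → encode u ≡ encode v → u ≡ v
  encode-injective {u} {v} eq = trans (sym (decode-encode u)) (trans (cong decode eq) (decode-encode v))
  g : Fin (3 ^ d) → Fin (3 ^ k)
  g = encode ∘ f ∘ decode
  g-injective : ∀ {i j} → g i ≡ g j → i ≡ j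
  g-injective {i} {j} eq = begin
    i                        ≡⟨ encode-decode {d} i ⟨
    encode (decode {d} i)    ≡⟨ cong encode (inj _ _ (encode-injective eq)) ⟩
    encode (decode {d} j)    ≡⟨ encode-decode {d} j ⟩
    j                        ∎
    where open ≡-Reasoning

infix 4 _↪_

record _↪_ (c′ : Colouring d) (c : Colouring n) : Set where
  constructor embedding
  field
    basis : Vec (V n) d
    injective : InjectiveLin basis
    recolours : (x : V d) → x ≢ zeroV d → col c (lin basis x) ≡ col c′ x

open _↪_ using (basis)

↪⇒Contains : {c0 : Colouring 2} {c : Colouring n} → c0 ↪ c → Contains c c0
↪⇒Contains (embedding ψ inj same) = ψ , inj , same

Contains⇒↪ : {c0 : Colouring 2} {c : Colouring n} → Contains c c0 → c0 ↪ c
Contains⇒↪ (ψ , inj , same) = embedding ψ inj same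

constant : (d : ℕ) → Bool → Colouring d
constant d β = record { col = λ _ → β ; inv = λ _ → refl }

restrict : Colouring (suc n) → Colouring n
restrict c = record { col = λ v → col c (f0 ∷ v) ; inv = λ v → inv c (f0 ∷ v) }

pullback : Colouring n → Vec (V n) d → Colouring d
pullback c ψ = record
  { col = λ x → col c (lin ψ x)
  ; inv = λ x → trans (cong (col c) (lin-scale ψ f2 x)) (inv c (lin ψ x))
  }

pullback-↪ : {c : Colouring n} (ψ : Vec (V n) d) → InjectiveLin ψ → pullback c ψ ↪ c
pullback-↪ ψ inj = embedding ψ inj λ _ _ → refl

↪-trans : {c₁ : Colouring d} {c₂ : Colouring k} {c₃ : Colouring n} →
          c₁ ↪ c₂ → c₂ ↪ c₃ → c₁ ↪ c₃
↪-trans {c₁ = c₁} {c₃ = c₃} (embedding φ injφ sameφ) (embedding ψ injψ sameψ) =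
  embedding (map (lin ψ) φ) injective same
  where
  injective : InjectiveLin (map (lin ψ) φ)
  injective x y eq = injφ x y (injψ _ _ (trans (sym (lin-comp ψ φ x)) (trans eq (lin-comp ψ φ y))))
  same : ∀ x → x ≢ zeroV _ → col c₃ (lin (map (lin ψ) φ) x) ≡ col c₁ x
  same x x≢0 = trans (cong (col c₃) (lin-comp ψ φ x))
                     (trans (sameψ (lin φ x) (lin-nonzero φ injφ x≢0)) (sameφ x x≢0))

↪-lift : {c′ : Colouring d} {c : Colouring (suc n)} → c′ ↪ restrict c → c′ ↪ c
↪-lift {c = c} (embedding ψ inj same) =
  embedding (map (f0 ∷_) ψ) (lift-injective ψ inj) λ x x≢0 →
    trans (cong (col c) (lin-lift ψ x)) (same x x≢0)

monoSubspace : {c : Colouring n} → constant d β ↪ c → MonoSubspace c d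
monoSubspace {β = β} (embedding X inj same) = X , inj , β , same

-- The projective line PG(1,3)

e10 e01 e11 e12 : V 2
e10 = f1 ∷ f0 ∷ []
e01 = f0 ∷ f1 ∷ []
e11 = f1 ∷ f1 ∷ []
e12 = f1 ∷ f2 ∷ []

patternColour : Bool → Bool → Bool → Bool → V 2 → Bool
patternColour _  _  _  _  (f0 ∷ f0 ∷ []) = false
patternColour b₁ _  _  _  (f1 ∷ f0 ∷ []) = b₁
patternColour b₁ _  _  _  (f2 ∷ f0 ∷ []) = b₁
patternColour _  b₂ _  _  (f0 ∷ f1 ∷ []) = b₂
patternColour _  b₂ _  _  (f0 ∷ f2 ∷ []) = b₂
patternColour _  _  b₃ _  (f1 ∷ f1 ∷ []) = b₃
patternColour _  _  b₃ _  (f2 ∷ f2 ∷ []) = b₃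
patternColour _  _  _  b₄ (f1 ∷ f2 ∷ []) = b₄
patternColour _  _  _  b₄ (f2 ∷ f1 ∷ []) = b₄

colour-pattern : (c : Colouring 2) (x : V 2) → x ≢ zeroV 2 →
                 col c x ≡ patternColour (col c e10) (col c e01) (col c e11) (col c e12) x
colour-pattern c (f0 ∷ f0 ∷ []) x≢0 = ⊥-elim (x≢0 refl)
colour-pattern c (f1 ∷ f0 ∷ []) _ = refl
colour-pattern c (f2 ∷ f0 ∷ []) _ = inv c e10
colour-pattern c (f0 ∷ f1 ∷ []) _ = refl
colour-pattern c (f0 ∷ f2 ∷ []) _ = inv c e01
colour-pattern c (f1 ∷ f1 ∷ []) _ = refl
colour-pattern c (f2 ∷ f2 ∷ []) _ = inv c e11
colour-pattern c (f1 ∷ f2 ∷ []) _ = refl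
colour-pattern c (f2 ∷ f1 ∷ []) _ = inv c e12

canonical : Colouring 2
canonical = record { col = colour ; inv = from-yes (∀V? λ x → colour (scale f2 x) ≟B colour x) }
  where
  colour : V 2 → Bool
  colour = patternColour true true false false

record Normaliser (b₁ b₂ b₃ b₄ : Bool) : Set where
  field
    to from : Vec (V 2) 2
    from∘to : ∀ x → lin from (lin to x) ≡ x
    to∘from : ∀ x → lin to (lin from x) ≡ x
    normalises : ∀ x → patternColour b₁ b₂ b₃ b₄ (lin to x) ≡ col canonical x

normaliser : ∀ {b₁ b₂ b₃ b₄} (to from : Vec (V 2) 2) →
  {True (∀V? (λ x → lin from (lin to x) ≟V x) ×-dec ∀V? (λ x → lin to (lin from x) ≟V x) ×-dec
         ∀V? (λ x → patternColour b₁ b₂ b₃ b₄ (lin to x) ≟B col canonical x))} →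
  Normaliser b₁ b₂ b₃ b₄
normaliser to from {checked} with toWitness checked
... | from∘to , to∘from , normalises = record
  { to = to ; from = from ; from∘to = from∘to ; to∘from = to∘from ; normalises = normalises }

-- PGL(2,3) acts on the four points of PG(1,3) as the full symmetric group.
balanced-normaliser : ∀ b₁ b₂ b₃ b₄ → count4 b₁ b₂ b₃ b₄ ≡ 2 → Normaliser b₁ b₂ b₃ b₄
balanced-normaliser true  true  false false _ = normaliser (e10 ∷ e01 ∷ []) (e10 ∷ e01 ∷ [])
balanced-normaliser true  false true  false _ = normaliser (e10 ∷ e11 ∷ []) (e10 ∷ (f2 ∷ f1 ∷ []) ∷ [])
balanced-normaliser true  false false true  _ = normaliser (e10 ∷ e12 ∷ []) (e10 ∷ e12 ∷ [])
balanced-normaliser false true  true  false _ = normaliser (e01 ∷ e11 ∷ []) ((f2 ∷ f1 ∷ []) ∷ e10 ∷ [])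
balanced-normaliser false true  false true  _ = normaliser (e01 ∷ e12 ∷ []) (e11 ∷ e10 ∷ [])
balanced-normaliser false false true  true  _ =
  normaliser (e11 ∷ e12 ∷ []) ((f2 ∷ f2 ∷ []) ∷ (f2 ∷ f1 ∷ []) ∷ [])
balanced-normaliser true  true  true  _     ()
balanced-normaliser true  true  false true  ()
balanced-normaliser true  false true  true  ()
balanced-normaliser false true  true  true  ()
balanced-normaliser true  false false false ()
balanced-normaliser false true  false false ()
balanced-normaliser false false true  false ()
balanced-normaliser false false false true  ()
balanced-normaliser false false false false ()

canonical↪ : (c : Colouring 2) → Balanced c → canonical ↪ c
canonical↪ c bal = embedding to to-injective λ x x≢0 →
  trans (colour-pattern c (lin to x) (lin-nonzero to to-injective x≢0)) (normalises x)
  where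
  N : Normaliser (col c e10) (col c e01) (col c e11) (col c e12)
  N = balanced-normaliser (col c e10) (col c e01) (col c e11) (col c e12) bal
  open Normaliser N using (to; from; from∘to; normalises)
  to-injective : InjectiveLin to
  to-injective x y eq = trans (sym (from∘to x)) (trans (cong (lin from) eq) (from∘to y))

↪canonical : (c : Colouring 2) → Balanced c → c ↪ canonical
↪canonical c bal = embedding from from-injective same
  where
  N : Normaliser (col c e10) (col c e01) (col c e11) (col c e12)
  N = balanced-normaliser (col c e10) (col c e01) (col c e11) (col c e12) bal
  open Normaliser N using (to; from; to∘from; normalises)
  from-injective : InjectiveLin from
  from-injective x y eq = trans (sym (to∘from x)) (trans (cong (lin to) eq) (to∘from y))
  same : ∀ x → x ≢ zeroV 2 → col canonical (lin from x) ≡ col c x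
  same x x≢0 = begin
    col canonical (lin from x)                                           ≡⟨ sym (normalises (lin from x)) ⟩
    patternColour (col c e10) (col c e01) (col c e11) (col c e12) (lin to (lin from x))
      ≡⟨ cong (patternColour _ _ _ _) (to∘from x) ⟩
    patternColour (col c e10) (col c e01) (col c e11) (col c e12) x     ≡⟨ sym (colour-pattern c x x≢0) ⟩
    col c x                                                              ∎
    where open ≡-Reasoning

balanced-↪ : (c₁ c₂ : Colouring 2) → Balanced c₁ → Balanced c₂ → c₁ ↪ c₂
balanced-↪ c₁ c₂ bal₁ bal₂ = ↪-trans (↪canonical c₁ bal₁) (canonical↪ c₂ bal₂)

lineCount : Colouring n → V n → V n → ℕ
lineCount c u v = count4 (col c u) (col c v) (col c (u ⊕ v)) (col c (u ⊖ v))

BalancedLine : Colouring n → Set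
BalancedLine {n} c = Σ (V n) λ u → Σ (V n) λ v → InjectiveLin (u ∷ v ∷ []) × lineCount c u v ≡ 2

count4-cong : ∀ {a b c d a′ b′ c′ d′} → a ≡ a′ → b ≡ b′ → c ≡ c′ → d ≡ d′ →
              count4 a b c d ≡ count4 a′ b′ c′ d′
count4-cong refl refl refl refl = refl

lin-e10 : (u v : V n) → lin (u ∷ v ∷ []) e10 ≡ u
lin-e10 u v = trans (lin-pair u v f1 f0) (trans (cong₂ _⊕_ (scale-one u) (scale-zero v)) (⊕-identityʳ u))

pullback-count : (c : Colouring n) (u v : V n) →
  count4 (col c (lin (u ∷ v ∷ []) e10)) (col c (lin (u ∷ v ∷ []) e01))
         (col c (lin (u ∷ v ∷ []) e11)) (col c (lin (u ∷ v ∷ []) e12)) ≡ lineCount c u v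
pullback-count c u v = count4-cong (cong (col c) (lin-e10 u v)) (cong (col c) e01↦v)
                                   (cong (col c) e11↦u⊕v) (cong (col c) e12↦u⊖v)
  where
  e01↦v : lin (u ∷ v ∷ []) e01 ≡ v
  e01↦v = trans (lin-pair u v f0 f1) (trans (cong₂ _⊕_ (scale-zero u) (scale-one v)) (⊕-identityˡ v))
  e11↦u⊕v : lin (u ∷ v ∷ []) e11 ≡ u ⊕ v
  e11↦u⊕v = trans (lin-pair u v f1 f1) (cong₂ _⊕_ (scale-one u) (scale-one v))
  e12↦u⊖v : lin (u ∷ v ∷ []) e12 ≡ u ⊖ v
  e12↦u⊖v = trans (lin-pair u v f1 f2) (cong (_⊕ scale f2 v) (scale-one u))

fourth-colour : ∀ β x → count4 β (not β) β x ≢ 2 → x ≡ β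
fourth-colour true  true  _ = refl
fourth-colour false false _ = refl
fourth-colour true  false unbalanced = ⊥-elim (unbalanced refl)
fourth-colour false true  unbalanced = ⊥-elim (unbalanced refl)

-- Parity of subsets of F3ᵐ

parity : (V m → Bool) → Bool
parity {zero} S = S []
parity {suc m} S =
  parity (λ v → S (f0 ∷ v)) xor (parity (λ v → S (f1 ∷ v)) xor parity (λ v → S (f2 ∷ v)))

any : (V m → Bool) → Bool
any {zero} S = S []
any {suc m} S = any (λ v → S (f0 ∷ v)) ∨ (any (λ v → S (f1 ∷ v)) ∨ any (λ v → S (f2 ∷ v)))

parity-cong : {S T : V m → Bool} → (∀ v → S v ≡ T v) → parity S ≡ parity T
parity-cong {zero} eq = eq []
parity-cong {suc m} eq = cong₂ _xor_ (parity-cong (eq ∘ (f0 ∷_)))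
                                     (cong₂ _xor_ (parity-cong (eq ∘ (f1 ∷_))) (parity-cong (eq ∘ (f2 ∷_))))

parity-const : (m : ℕ) (b : Bool) → parity {m} (λ _ → b) ≡ b
parity-const zero b = refl
parity-const (suc m) b rewrite parity-const m b = trans (cong (b xor_) (xor-same b)) (xor-identityʳ b)

parity-xor : (S T : V m → Bool) → parity (λ v → S v xor T v) ≡ parity S xor parity T
parity-xor {zero} S T = refl
parity-xor {suc m} S T = begin
  parity (λ v → S (f0 ∷ v) xor T (f0 ∷ v)) xor
    (parity (λ v → S (f1 ∷ v) xor T (f1 ∷ v)) xor parity (λ v → S (f2 ∷ v) xor T (f2 ∷ v)))
    ≡⟨ cong₂ _xor_ (sliced f0) (cong₂ _xor_ (sliced f1) (sliced f2)) ⟩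
  (p S f0 xor p T f0) xor ((p S f1 xor p T f1) xor (p S f2 xor p T f2))
    ≡⟨ cong ((p S f0 xor p T f0) xor_) (interchange (p S f1) (p T f1) (p S f2) (p T f2)) ⟩
  (p S f0 xor p T f0) xor ((p S f1 xor p S f2) xor (p T f1 xor p T f2))
    ≡⟨ interchange (p S f0) (p T f0) (p S f1 xor p S f2) (p T f1 xor p T f2) ⟩
  (p S f0 xor (p S f1 xor p S f2)) xor (p T f0 xor (p T f1 xor p T f2)) ∎
  where
  open ≡-Reasoning
  p : (V (suc m) → Bool) → F3 → Bool
  p U a = parity (λ v → U (a ∷ v))
  sliced : ∀ a → parity (λ v → S (a ∷ v) xor T (a ∷ v)) ≡ p S a xor p T a
  sliced a = parity-xor (λ v → S (a ∷ v)) (λ v → T (a ∷ v))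

parity-not : (S : V m → Bool) → parity (λ v → not (S v)) ≡ not (parity S)
parity-not {m} S = trans (parity-xor (λ _ → true) S) (cong (_xor parity S) (parity-const m true))

parity-swap : (F : V m → V n → Bool) →
              parity (λ y → parity (F y)) ≡ parity (λ z → parity (λ y → F y z))
parity-swap {zero} F = refl
parity-swap {suc m} F = begin
  P f0 xor (P f1 xor P f2)
    ≡⟨ cong₂ _xor_ (swapped f0) (cong₂ _xor_ (swapped f1) (swapped f2)) ⟩
  Q f0 xor (Q f1 xor Q f2)                      ≡⟨ cong (Q f0 xor_) (sym (parity-xor (R f1) (R f2))) ⟩
  Q f0 xor parity (λ z → R f1 z xor R f2 z)     ≡⟨ sym (parity-xor (R f0) (λ z → R f1 z xor R f2 z)) ⟩
  parity (λ z → R f0 z xor (R f1 z xor R f2 z)) ∎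
  where
  open ≡-Reasoning
  P : F3 → Bool
  P a = parity (λ y → parity (F (a ∷ y)))
  R : F3 → V _ → Bool
  R a z = parity (λ y → F (a ∷ y) z)
  Q : F3 → Bool
  Q a = parity (R a)
  swapped : ∀ a → P a ≡ Q a
  swapped a = parity-swap (λ y → F (a ∷ y))

any-complete : (S : V m → Bool) (v : V m) → S v ≡ true → any S ≡ true
any-complete S [] Sv = Sv
any-complete S (f0 ∷ v) Sv rewrite any-complete (λ w → S (f0 ∷ w)) v Sv = refl
any-complete S (f1 ∷ v) Sv rewrite any-complete (λ w → S (f1 ∷ w)) v Sv = ∨-zeroʳ (any (λ w → S (f0 ∷ w)))
any-complete S (f2 ∷ v) Sv rewrite any-complete (λ w → S (f2 ∷ w)) v Sv
  | ∨-zeroʳ (any (λ w → S (f1 ∷ w))) = ∨-zeroʳ (any (λ w → S (f0 ∷ w)))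

any-sound : (S : V m → Bool) → any S ≡ true → ∃ λ v → S v ≡ true
any-sound {zero} S found = [] , found
any-sound {suc m} S found with any (λ v → S (f0 ∷ v)) in found₀ | any (λ v → S (f1 ∷ v)) in found₁
... | true  | _     = Product.map (f0 ∷_) id (any-sound (λ v → S (f0 ∷ v)) found₀)
... | false | true  = Product.map (f1 ∷_) id (any-sound (λ v → S (f1 ∷ v)) found₁)
... | false | false = Product.map (f2 ∷_) id (any-sound (λ v → S (f2 ∷ v)) found)

xor≡∨ : ∀ {p q r} → (p ≡ true → q ≡ true → r ≡ true) → (p ≡ true → r ≡ true → q ≡ true) →
        (q ≡ true → r ≡ true → p ≡ true) → p xor (q xor r) ≡ p ∨ (q ∨ r)
xor≡∨ {true}  {true}  {true}  _ _ _ = refl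
xor≡∨ {true}  {true}  {false} pq⇒r _ _ = pq⇒r refl refl
xor≡∨ {true}  {false} {true}  _ pr⇒q _ = pr⇒q refl refl
xor≡∨ {true}  {false} {false} _ _ _ = refl
xor≡∨ {false} {true}  {true}  _ _ qr⇒p = qr⇒p refl refl
xor≡∨ {false} {true}  {false} _ _ _ = refl
xor≡∨ {false} {false} {true}  _ _ _ = refl
xor≡∨ {false} {false} {false} _ _ _ = refl

-- y, y ⊕ w and (y ⊕ w) ⊕ w are the three points of an affine line.
Closed : (V m → Set) → Set
Closed {m} P = ∀ y w → w ≢ zeroV m → P y → P (y ⊕ w) → P ((y ⊕ w) ⊕ w)

closed-resp : (P Q : V m → Set) → (∀ {v} → P v → Q v) → (∀ {v} → Q v → P v) → Closed P → Closed Q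
closed-resp P Q to from closed y w w≢0 Qy Qyw = to (closed y w w≢0 (from Qy) (from Qyw))

closed-slice : (P : V (suc m) → Set) → Closed P → (a : F3) → Closed (λ v → P (a ∷ v))
closed-slice P closed a y w w≢0 Py Pyw =
  subst (λ t → P (t ∷ ((y ⊕ w) ⊕ w))) (trans (+₃-identityʳ (a +₃ f0)) (+₃-identityʳ a))
    (closed (a ∷ y) (f0 ∷ w) (w≢0 ∘ ∷-injectiveʳ) Py
      (subst (λ t → P (t ∷ (y ⊕ w))) (sym (+₃-identityʳ a)) Pyw))

closed-through : (P : V m → Set) {u v : V m} → Closed P → u ≢ v → P u → P v → P (v ⊕ (v ⊖ u))
closed-through P {u} {v} closed u≢v Pu Pv =
  subst (λ x → P (x ⊕ (v ⊖ u))) (u⊕[v⊖u]≡v u v)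
    (closed u (v ⊖ u) (u≢v ∘ sym ∘ ⊖≡0⇒≡ v u) Pu (subst P (sym (u⊕[v⊖u]≡v u v)) Pv))

-- A nonempty closed set is an affine subspace, with an odd number 3ᵏ of points.
parity-closed : (S : V m → Bool) → Closed (λ v → S v ≡ true) → parity S ≡ any S
parity-closed {zero} S _ = refl
parity-closed {suc m} S closed = trans
  (cong₂ _xor_ (slice f0) (cong₂ _xor_ (slice f1) (slice f2)))
  (xor≡∨ (third f0 f1 λ ()) (third f0 f2 λ ()) (third f1 f2 λ ()))
  where
  slice : ∀ a → parity (λ v → S (a ∷ v)) ≡ any (λ v → S (a ∷ v))
  slice a = parity-closed (λ v → S (a ∷ v)) (closed-slice (λ v → S v ≡ true) closed a)
  third : (a b : F3) → a ≢ b → any (λ v → S (a ∷ v)) ≡ true → any (λ v → S (b ∷ v)) ≡ true →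
          any (λ v → S ((b +₃ (b +₃ (f2 *₃ a))) ∷ v)) ≡ true
  third a b a≢b Sa Sb with any-sound (λ v → S (a ∷ v)) Sa | any-sound (λ v → S (b ∷ v)) Sb
  ... | y , Say | z , Sbz = any-complete (λ v → S ((b +₃ (b +₃ (f2 *₃ a))) ∷ v)) (z ⊕ (z ⊖ y))
    (closed-through (λ v → S v ≡ true) closed (a≢b ∘ ∷-injectiveˡ) Say Sbz)

parity-of-closed : (S : V m → Bool) (β : Bool) → Closed (λ v → S v ≡ β) → ∃ (λ v → S v ≡ β) →
                   parity S ≡ β
parity-of-closed S true closed (v , Sv) = trans (parity-closed S closed) (any-complete S v Sv)
parity-of-closed S false closed (v , Sv) = not-injective (trans (sym (parity-not S))
  (parity-of-closed (λ v → not (S v)) true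
    (closed-resp (λ v → S v ≡ false) (λ v → not (S v) ≡ true) (cong not) not-injective closed)
    (v , cong not Sv)))

grid-contradiction : (G : V m → V n → Bool) → (∀ z → parity (λ y → G y z) ≡ false) →
                     (∀ y → parity (G y) ≡ true) → ⊥
grid-contradiction {m} {n} G rows cols with (begin
  true                                 ≡⟨ sym (parity-const m true) ⟩
  parity {m} (λ _ → true)              ≡⟨ parity-cong (sym ∘ cols) ⟩
  parity (λ y → parity (G y))          ≡⟨ parity-swap G ⟩
  parity (λ z → parity (λ y → G y z))  ≡⟨ parity-cong rows ⟩
  parity {n} (λ _ → false)             ≡⟨ parity-const n false ⟩
  false                                ∎)
  where open ≡-Reasoning
... | ()

search : {P Q : V m → Set} → (∀ v → P v ⊎ Q v) → ∃ P ⊎ (∀ v → Q v)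
search {zero} decide with decide []
... | inj₁ p = inj₁ ([] , p)
... | inj₂ q = inj₂ λ { [] → q }
search {suc m} decide
  with search (decide ∘ (f0 ∷_)) | search (decide ∘ (f1 ∷_)) | search (decide ∘ (f2 ∷_))
... | inj₁ (v , p) | _            | _            = inj₁ (f0 ∷ v , p)
... | inj₂ _       | inj₁ (v , p) | _            = inj₁ (f1 ∷ v , p)
... | inj₂ _       | inj₂ _       | inj₁ (v , p) = inj₁ (f2 ∷ v , p)
... | inj₂ q₀      | inj₂ q₁      | inj₂ q₂      =
  inj₂ λ { (f0 ∷ v) → q₀ v ; (f1 ∷ v) → q₁ v ; (f2 ∷ v) → q₂ v }

all-or-counterexample : (S : V m → Bool) (β : Bool) → (∀ v → S v ≡ β) ⊎ ∃ λ v → S v ≡ not β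
all-or-counterexample S β = Sum.swap (search λ v → decide (S v))
  where
  decide : (b : Bool) → b ≡ not β ⊎ b ≡ β
  decide b with b ≟B β
  ... | yes b≡β = inj₂ b≡β
  ... | no b≢β = inj₁ (¬-not b≢β)

cone-↪ : (c : Colouring (suc m)) (mono : constant k β ↪ restrict c) (q : V m) →
         (∀ y → col c (f1 ∷ (q ⊕ lin (basis mono) y)) ≡ β) → constant (suc k) β ↪ c
cone-↪ {β = β} c (embedding X injX monoX) q affine = embedding (cone q X) (cone-injective q X injX) colour
  where
  colour : ∀ x → x ≢ zeroV _ → col c (lin (cone q X) x) ≡ β
  colour (t ∷ y) x≢0 rewrite lin-cone q X t y with t
  ... | f0 rewrite scale-zero q | ⊕-identityˡ (lin X y) = monoX y (x≢0 ∘ cong (f0 ∷_))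
  ... | f1 rewrite scale-one q = affine y
  ... | f2 = trans (cong (λ p → col c (f2 ∷ p)) reflected)
                   (trans (inv c (f1 ∷ (q ⊕ lin X (scale f2 y)))) (affine (scale f2 y)))
    where
    reflected : scale f2 q ⊕ lin X y ≡ scale f2 (q ⊕ lin X (scale f2 y))
    reflected = sym (trans (scale-⊕ f2 q _)
      (cong (scale f2 q ⊕_) (trans (cong (scale f2) (lin-scale X f2 y)) (scale-f2-involutive _))))

record MonoSplit (c : Colouring n) : Set where
  constructor monoSplit
  field
    red-dim blue-dim : ℕ
    dims : red-dim + blue-dim ≡ n
    red : constant red-dim true ↪ c
    blue : constant blue-dim false ↪ c

⌈n/2⌉≤1+⌊n/2⌋ : ∀ n → ⌈ n /2⌉ ≤ suc ⌊ n /2⌋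
⌈n/2⌉≤1+⌊n/2⌋ zero = z≤n
⌈n/2⌉≤1+⌊n/2⌋ (suc zero) = s≤s z≤n
⌈n/2⌉≤1+⌊n/2⌋ (suc (suc n)) = s≤s (⌈n/2⌉≤1+⌊n/2⌋ n)

larger-half : ∀ {a b} → a + b ≡ n → ⌈ n /2⌉ ≤ a ⊎ ⌈ n /2⌉ ≤ b
larger-half {n} {a} {b} a+b≡n with ⌈ n /2⌉ ≤? a
... | yes ≤a = inj₁ ≤a
... | no ≰a = inj₂ (≤-trans (⌈n/2⌉≤1+⌊n/2⌋ n)
                          (≰⇒> λ b≤⌊n/2⌋ → <-irrefl halves (+-mono-<-≤ (≰⇒> ≰a) b≤⌊n/2⌋)))
  where
  halves : a + b ≡ ⌈ n /2⌉ + ⌊ n /2⌋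
  halves = trans a+b≡n (sym (trans (+-comm ⌈ n /2⌉ ⌊ n /2⌋) (⌊n/2⌋+⌈n/2⌉≡n n)))

-- The alternating colouring

leadingZerosEven : V n → Bool
leadingZerosEven [] = false
leadingZerosEven (f0 ∷ v) = not (leadingZerosEven v)
leadingZerosEven (f1 ∷ _) = true
leadingZerosEven (f2 ∷ _) = true

leadingZerosEven-scale : (v : V n) → leadingZerosEven (scale f2 v) ≡ leadingZerosEven v
leadingZerosEven-scale [] = refl
leadingZerosEven-scale (f0 ∷ v) = cong not (leadingZerosEven-scale v)
leadingZerosEven-scale (f1 ∷ v) = refl
leadingZerosEven-scale (f2 ∷ v) = refl

alternating : (n : ℕ) → Colouring n
alternating n = record { col = leadingZerosEven ; inv = leadingZerosEven-scale }

count4-not : ∀ a b c d → count4 (not a) (not b) (not c) (not d) ≡ 2 → count4 a b c d ≡ 2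
count4-not = from-yes (∀B? λ a → ∀B? λ b → ∀B? λ c → ∀B? λ d →
  (count4 (not a) (not b) (not c) (not d) ≟ℕ 2) →-dec (count4 a b c d ≟ℕ 2))

three-true₁ : ∀ x → count4 x true true true ≢ 2
three-true₁ true ()
three-true₁ false ()

three-true₂ : ∀ x → count4 true x true true ≢ 2
three-true₂ true ()
three-true₂ false ()

three-true₃ : ∀ x → count4 true true x true ≢ 2
three-true₃ true ()
three-true₃ false ()

three-true₄ : ∀ x → count4 true true true x ≢ 2
three-true₄ _ ()

-- If the first coordinates of u and v are not both 0, exactly three of the four points
-- have a nonzero first coordinate, and these are coloured true; otherwise every colour flips.
alternating-unbalanced : (u v : V n) → u ≢ zeroV n → lineCount (alternating n) u v ≢ 2
alternating-unbalanced [] [] u≢0 = ⊥-elim (u≢0 refl)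
alternating-unbalanced (f0 ∷ u) (f0 ∷ v) u≢0 =
  alternating-unbalanced u v (u≢0 ∘ cong (f0 ∷_)) ∘
    count4-not (leadingZerosEven u) (leadingZerosEven v) (leadingZerosEven (u ⊕ v)) (leadingZerosEven (u ⊖ v))
alternating-unbalanced (f0 ∷ u) (f1 ∷ v) _ = three-true₁ _
alternating-unbalanced (f0 ∷ u) (f2 ∷ v) _ = three-true₁ _
alternating-unbalanced (f1 ∷ u) (f0 ∷ v) _ = three-true₂ _
alternating-unbalanced (f2 ∷ u) (f0 ∷ v) _ = three-true₂ _
alternating-unbalanced (f1 ∷ u) (f2 ∷ v) _ = three-true₃ _
alternating-unbalanced (f2 ∷ u) (f1 ∷ v) _ = three-true₃ _
alternating-unbalanced (f1 ∷ u) (f1 ∷ v) _ = three-true₄ _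
alternating-unbalanced (f2 ∷ u) (f2 ∷ v) _ = three-true₄ _

half : Bool → ℕ → ℕ
half true n = ⌈ n /2⌉
half false n = ⌊ n /2⌋

half-≤ : ∀ b n → half b n ≤ ⌈ n /2⌉
half-≤ true n = ≤-refl
half-≤ false n = ⌊n/2⌋≤⌈n/2⌉ n

pick : (b : Bool) → V n → V (half b n)
pick true [] = []
pick false [] = []
pick true (x ∷ v) = x ∷ pick false v
pick false (x ∷ v) = pick true v

pick-⊖ : (b : Bool) (u v : V n) → pick b (u ⊖ v) ≡ pick b u ⊖ pick b v
pick-⊖ true [] [] = refl
pick-⊖ false [] [] = refl
pick-⊖ true (x ∷ u) (y ∷ v) = cong (_ ∷_) (pick-⊖ false u v)
pick-⊖ false (x ∷ u) (y ∷ v) = pick-⊖ true u v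

pick-nonzero : (b : Bool) (x : V n) → x ≢ zeroV n → leadingZerosEven x ≡ b → pick b x ≢ zeroV (half b n)
pick-nonzero b [] x≢0 _ = ⊥-elim (x≢0 refl)
pick-nonzero true (f0 ∷ x) x≢0 even =
  pick-nonzero false x (x≢0 ∘ cong (f0 ∷_)) (not-injective even) ∘ ∷-injectiveʳ
pick-nonzero true (f1 ∷ x) _ _ ()
pick-nonzero true (f2 ∷ x) _ _ ()
pick-nonzero false (f0 ∷ x) x≢0 odd = pick-nonzero true x (x≢0 ∘ cong (f0 ∷_)) (not-injective odd)
pick-nonzero false (f1 ∷ x) _ ()
pick-nonzero false (f2 ∷ x) _ ()

alternating-mono-≤ : MonoSubspace (alternating n) d → d ≤ ⌈ n /2⌉
alternating-mono-≤ {n} (X , injX , β , mono) = ≤-trans (injective⇒dim≤ f f-injective) (half-≤ β n)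
  where
  f : V _ → V (half β n)
  f x = pick β (lin X x)
  f-injective : ∀ x y → f x ≡ f y → x ≡ y
  f-injective = kernel-trivial⇒injective f (λ x y → trans (cong (pick β) (lin-⊖ X x y)) (pick-⊖ β _ _))
    λ x x≢0 → pick-nonzero β (lin X x) (lin-nonzero X injX x≢0) (mono x x≢0)

-- Colourings avoiding a balanced colouring of PG(1,3)

module _ (c0 : Colouring 2) (c0-balanced : Balanced c0) where

  balancedLine⇒↪ : (c : Colouring n) → BalancedLine c → c0 ↪ c
  balancedLine⇒↪ c (u , v , inj , balanced) =
    ↪-trans (balanced-↪ c0 (pullback c (u ∷ v ∷ [])) c0-balanced (trans (pullback-count c u v) balanced))
            (pullback-↪ (u ∷ v ∷ []) inj)

  ↪⇒balancedLine : (c : Colouring n) → c0 ↪ c → BalancedLine c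
  ↪⇒balancedLine c (embedding (u ∷ v ∷ []) inj same) =
    u , v , inj ,
    trans (sym (pullback-count c u v))
          (trans (count4-cong (same e10 λ ()) (same e01 λ ()) (same e11 λ ()) (same e12 λ ())) c0-balanced)

  alternating-free : Free (alternating n) c0
  alternating-free contained with ↪⇒balancedLine (alternating _) (Contains⇒↪ contained)
  ... | u , v , inj , balanced =
    alternating-unbalanced u v (λ u≡0 → lin-nonzero (u ∷ v ∷ []) {e10} inj (λ ()) (trans (lin-e10 u v) u≡0))
      balanced

  restrict-free : (c : Colouring (suc n)) → Free c c0 → Free (restrict c) c0
  restrict-free c free = free ∘ ↪⇒Contains ∘ ↪-lift {c = c} ∘ Contains⇒↪ {c0 = c0} {c = restrict c}

  line-rule : (c : Colouring n) (u v : V n) → Free c c0 → InjectiveLin (u ∷ v ∷ []) →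
              col c v ≡ not β → col c u ≡ β → col c (u ⊕ v) ≡ β → col c (u ⊖ v) ≡ β
  line-rule {β = β} c u v free inj cv cu cuv = fourth-colour β (col c (u ⊖ v)) λ balanced →
    free (↪⇒Contains (balancedLine⇒↪ c (u , v , inj , trans (count4-cong cu cv cuv refl) balanced)))

  affine-closed : (c : Colouring (suc m)) → Free c c0 → (mono : constant k (not β) ↪ restrict c) (q : V m) →
                  Closed (λ y → col c (f1 ∷ (q ⊕ lin (basis mono) y)) ≡ β)
  affine-closed {β = β} c free (embedding X injX monoX) q y w w≢0 on-y on-y+w =
    subst (λ p → col c (f1 ∷ p) ≡ β) (sym twice)
      (line-rule c (f1 ∷ (q ⊕ lin X y)) (f0 ∷ lin X w) free
        (cone-injective _ _ (singleton-injective _ (lin-nonzero X injX w≢0))) (monoX w w≢0) on-y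
        (subst (λ p → col c (f1 ∷ p) ≡ β) (step y) on-y+w))
    where
    step : ∀ x → q ⊕ lin X (x ⊕ w) ≡ (q ⊕ lin X x) ⊕ lin X w
    step x = trans (cong (q ⊕_) (lin-⊕ X x w)) (sym (⊕-assoc q _ _))
    twice : q ⊕ lin X ((y ⊕ w) ⊕ w) ≡ (q ⊕ lin X y) ⊖ lin X w
    twice = trans (step (y ⊕ w)) (trans (cong (_⊕ lin X w) (step y)) (⊕-twice _ _))

  split-extend : (c : Colouring (suc m)) → Free c c0 → MonoSplit (restrict c) → MonoSplit c
  split-extend {m} c free (monoSplit a b dims red blue) = extend
    where
    R : Vec (V m) a
    R = basis red
    B : Vec (V m) b
    B = basis blue
    G : V a → V b → Bool
    G y z = col c (f1 ∷ (lin R y ⊕ lin B z))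
    rows-closed : ∀ z → Closed (λ y → G y z ≡ false)
    rows-closed z = closed-resp _ _
      (λ {y} → subst (λ p → col c (f1 ∷ p) ≡ false) (⊕-comm (lin B z) (lin R y)))
      (λ {y} → subst (λ p → col c (f1 ∷ p) ≡ false) (⊕-comm (lin R y) (lin B z)))
      (affine-closed {β = false} c free red (lin B z))
    cols-closed : ∀ y → Closed (λ z → G y z ≡ true)
    cols-closed y = affine-closed {β = true} c free blue (lin R y)
    extend : MonoSplit c
    extend with search (λ z → all-or-counterexample (λ y → G y z) true)
    ... | inj₁ (z , red-row) =
      monoSplit (suc a) b (cong suc dims)
        (cone-↪ c red (lin B z) λ y →
          trans (cong (λ p → col c (f1 ∷ p)) (⊕-comm (lin B z) (lin R y))) (red-row y))
        (↪-lift blue)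
    ... | inj₂ rows-blue with search (λ y → all-or-counterexample (G y) false)
    ...   | inj₁ (y , blue-col) =
      monoSplit a (suc b) (trans (+-suc a b) (cong suc dims)) (↪-lift red) (cone-↪ c blue (lin R y) blue-col)
    ...   | inj₂ cols-red = ⊥-elim (grid-contradiction G
      (λ z → parity-of-closed (λ y → G y z) false (rows-closed z) (rows-blue z))
      (λ y → parity-of-closed (G y) true (cols-closed y) (cols-red y)))

  monochromatic-split : (c : Colouring n) → Free c c0 → MonoSplit c
  monochromatic-split {zero} c _ = monoSplit 0 0 refl zero-dim zero-dim
    where
    zero-dim : constant 0 β ↪ c
    zero-dim = embedding [] (λ { [] [] _ → refl }) λ { [] []≢0 → ⊥-elim ([]≢0 refl) }
  monochromatic-split {suc n} c free =
    split-extend c free (monochromatic-split (restrict c) (restrict-free c free))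

  free⇒mono-⌈n/2⌉ : (c : Colouring n) → Free c c0 → HasMonoAtLeast c ⌈ n /2⌉
  free⇒mono-⌈n/2⌉ c free with monochromatic-split c free
  ... | monoSplit a b dims red blue with larger-half dims
  ...   | inj₁ ≤a = a , ≤a , monoSubspace red
  ...   | inj₂ ≤b = b , ≤b , monoSubspace blue

theorem10p1 : (c0 : Colouring 2) → Balanced c0 → (n : ℕ) → 2 ≤ n →
    ((c : Colouring n) → Free c c0 → HasMonoAtLeast c ⌈ n /2⌉)
    × Σ (Colouring n) (λ c → Free c c0 × ((d : ℕ) → MonoSubspace c d → d ≤ ⌈ n /2⌉))
theorem10p1 c0 bal n _ =
  free⇒mono-⌈n/2⌉ c0 bal , alternating n , alternating-free c0 bal , λ _ → alternating-mono-≤
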